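{- Let $S$ be a numerical semigroup and let $k\ge 2$. If $A_k\ne\emptyset$ and $A_i=\emptyset$ for all $1\le i\le k-1$, then $A_k=P_k$.
   Context: A numerical semigroup is a submonoid $S$ of $(\mathbb N,+)$ with $\mathbb N\setminus S$ finite; $S^*=S\setminus\{0\}$, $m=\min S^*$, $c$ is the least $c\in\mathbb N$ with $[c,\infty[\subseteq S$, $q=\lceil c/m\rceil$, $\rho=qm-c\in[0,m-1]$. $P$ is the set of primitive elements (elements of $S^*$ not expressible as a sum of two elements of $S^*$). For $j\in\mathbb Z$ let $I_j=[jm-\rho,(j+1)m-\rho-1]$ and $P_j=P\cap I_j$. $A=\{x\in S: x-m\notin S\}$ is the Apéry set with respect to $m$, and $A_i=A\cap I_i$. -}

module Defs where

open import Level using (0ℓ)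
open import Data.Nat using (ℕ; zero; suc; _+_; _*_; _∸_; _≤_; _<_; _≥_; NonZero)
open import Data.Nat.DivMod using (_/_)
open import Data.Product using (Σ; ∃; _×_; _,_)
open import Relation.Nullary using (¬_)
open import Relation.Binary.PropositionalEquality using (_≡_)

record NumericalSemigroup : Set₁ where
  field
    _∈S    : ℕ → Set
    0∈S    : zero ∈S
    +-closed : ∀ {x y} → x ∈S → y ∈S → (x + y) ∈S
    cofinite : Σ ℕ λ b → ∀ n → b ≤ n → n ∈S

module _ (S : NumericalSemigroup) where
  open NumericalSemigroup S

  InS* : ℕ → Set
  InS* x = x ∈S × 0 < x

  IsMultiplicity : ℕ → Set
  IsMultiplicity m = InS* m × (∀ x → InS* x → m ≤ x)

  IsConductor : ℕ → Set
  IsConductor c = (∀ n → c ≤ n → n ∈S)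
                × (∀ d → (∀ n → d ≤ n → n ∈S) → c ≤ d)

  Primitive : ℕ → Set
  Primitive x = InS* x × ¬ (Σ ℕ λ a → Σ ℕ λ b → InS* a × InS* b × a + b ≡ x)

  -- Apéry set w.r.t. m: x ∈ S with x - m ∉ S (x - m computed in ℤ, so
  -- x - m ∈ S iff there is y ∈ S with y + m = x)
  Apery : ℕ → ℕ → Set
  Apery m x = x ∈S × ¬ (Σ ℕ λ y → y ∈S × y + m ≡ x)

ceilDiv : (c m : ℕ) → .{{NonZero m}} → ℕ
ceilDiv c m = (c + (m ∸ 1)) / m

qOf : (c m : ℕ) → .{{NonZero m}} → ℕ
qOf c m = ceilDiv c m

ρOf : (c m : ℕ) → .{{NonZero m}} → ℕ
ρOf c m = qOf c m * m ∸ c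

-- x ∈ I_j = [jm - ρ, (j+1)m - ρ - 1]  (for x ∈ ℕ), i.e. jm ≤ x + ρ < (j+1)m
InI : (c m : ℕ) → .{{NonZero m}} → ℕ → ℕ → Set
InI c m j x = (j * m ≤ x + ρOf c m) × (x + ρOf c m < suc j * m)

module Submission where

open import Defs
open import Data.Nat using (ℕ; suc; _≤_; _<_; NonZero)
open import Data.Product using (Σ; _×_)
open import Data.Empty using (⊥)

open import Data.Empty using (⊥-elim)
open import Data.Nat using (_<?_; zero; _+_; _*_; _∸_; z≤n; z<s; s≤s)
open import Data.Nat.Properties
open import Data.Nat.DivMod using (_/_; m/n*n≤m; m≡m%n+[m/n]*n; m%n<n)
open import Data.Nat.Tactic.RingSolver using (solve)
open import Data.List using (_∷_; [])
open import Data.Product using (_,_; proj₁; proj₂)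
open import Relation.Binary.PropositionalEquality
  using (_≡_; _≢_; refl; sym; subst; cong; module ≡-Reasoning)
open import Relation.Nullary using (¬_; contradiction; yes; no)

-- An Apéry element a > 0 is at least m, so a + ρ ≥ m; when A_1, …, A_{k-1}
-- are empty it therefore lies in I_j for some j ≥ k.  Summands of an Apéry
-- element are Apéry, and for k ≥ 2 a sum of two elements of ⋃_{j ≥ k} I_j lies
-- beyond I_k, so no element of A_k decomposes.  Conversely a primitive x cannot
-- be y + m with y ∈ S*, and x = m is excluded because m ∈ I_1.

ρOf<m : ∀ c m .{{_ : NonZero m}} → ρOf c m < m
ρOf<m c (suc m-1) = begin-strict
  ((c + m-1) / suc m-1) * suc m-1 ∸ c ≤⟨ ∸-monoˡ-≤ c (m/n*n≤m (c + m-1) (suc m-1)) ⟩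
  c + m-1 ∸ c                          ≡⟨ m+n∸m≡n c m-1 ⟩
  m-1                                  <⟨ n<1+n m-1 ⟩
  suc m-1                              ∎
  where open ≤-Reasoning

block-index : ∀ m .{{_ : NonZero m}} n → Σ ℕ λ j → j * m ≤ n × n < suc j * m
block-index m n = n / m , m/n*n≤m n m , subst (_< m + n / m * m) (sym (m≡m%n+[m/n]*n n m))
  (+-monoˡ-< (n / m * m) (m%n<n n m))

block-index-≤ : ∀ {i j m n} → i * m ≤ n → n < suc j * m → i ≤ j
block-index-≤ {i} {j} {m} i*m≤n n<[1+j]*m =
  m<1+n⇒m≤n (*-cancelʳ-< m i (suc j) (≤-<-trans i*m≤n n<[1+j]*m))

high-block-sum : ∀ {k m ρ a b} → 2 ≤ k → ρ < m → k * m ≤ a + ρ → k * m ≤ b + ρ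
  → suc k * m ≤ a + b + ρ
high-block-sum {k} {m} {ρ} {a} {b} 2≤k ρ<m k*m≤a+ρ k*m≤b+ρ =
  +-cancelʳ-≤ m (suc k * m) (a + b + ρ) (begin
  suc k * m + m         ≡⟨ solve (k ∷ m ∷ []) ⟩
  2 * m + k * m         ≤⟨ +-monoˡ-≤ (k * m) (*-monoˡ-≤ m 2≤k) ⟩
  k * m + k * m         ≤⟨ +-mono-≤ k*m≤a+ρ k*m≤b+ρ ⟩
  (a + ρ) + (b + ρ)     ≡⟨ solve (a ∷ b ∷ ρ ∷ []) ⟩
  (a + b + ρ) + ρ       ≤⟨ +-monoʳ-≤ (a + b + ρ) (<⇒≤ ρ<m) ⟩
  (a + b + ρ) + m       ∎)
  where open ≤-Reasoning

zero∈I₀ : ∀ c m .{{_ : NonZero m}} → InI c m 0 0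
zero∈I₀ c m = z≤n , subst (ρOf c m <_) (sym (*-identityˡ m)) (ρOf<m c m)

multiplicity∈I₁ : ∀ c m .{{_ : NonZero m}} → InI c m 1 m
multiplicity∈I₁ c m = ≤-trans (≤-reflexive (*-identityˡ m)) (m≤m+n m (ρOf c m))
  , +-monoʳ-< m (proj₂ (zero∈I₀ c m))

InI⇒index-≤ : ∀ c m .{{_ : NonZero m}} {i j x} → InI c m i x → InI c m j x → i ≤ j
InI⇒index-≤ c m (i*m≤x+ρ , _) (_ , x+ρ<[1+j]m) = block-index-≤ i*m≤x+ρ x+ρ<[1+j]m

module _ (S : NumericalSemigroup) where
  open NumericalSemigroup S

  NoAperyBetween : (c m : ℕ) .{{_ : NonZero m}} → ℕ → Set
  NoAperyBetween c m k = ∀ i → 1 ≤ i → i < k → ∀ x → Apery S m x → InI c m i x → ⊥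

  Apery-summand : ∀ {m a b} → a ∈S → b ∈S → Apery S m (a + b) → Apery S m a
  Apery-summand {m} {a} {b} a∈S b∈S (_ , a+b∉m+S) = a∈S , a∉m+S
    where
      open ≡-Reasoning
      a∉m+S : ¬ Σ ℕ λ y → y ∈S × y + m ≡ a
      a∉m+S (y , y∈S , y+m≡a) = a+b∉m+S (y + b , +-closed y∈S b∈S , (begin
        y + b + m ≡⟨ solve (y ∷ b ∷ m ∷ []) ⟩
        y + m + b ≡⟨ cong (_+ b) y+m≡a ⟩
        a + b     ∎))

  Apery-in-high-block : ∀ c {m} k .{{_ : NonZero m}} → IsMultiplicity S m → NoAperyBetween c m k
    → ∀ {a} → Apery S m a → 0 < a → k * m ≤ a + ρOf c m
  Apery-in-high-block c {m} k (_ , m-minimal) noApery {a} a∈A 0<a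
    with block-index m (a + ρOf c m)
  ... | zero , _ , a+ρ<m =
    contradiction (≤-trans (m-minimal a (proj₁ a∈A , 0<a)) (m≤m+n a (ρOf c m)))
      (<⇒≱ (subst (a + ρOf c m <_) (+-identityʳ m) a+ρ<m))
  ... | suc j , a∈I₁₊ⱼ with suc j <? k
  ...   | yes 1+j<k = ⊥-elim (noApery (suc j) (s≤s z≤n) 1+j<k a a∈A a∈I₁₊ⱼ)
  ...   | no 1+j≮k = ≤-trans (*-monoˡ-≤ m (≮⇒≥ 1+j≮k)) (proj₁ a∈I₁₊ⱼ)

  Apery⇒Primitive : ∀ c {m} k .{{_ : NonZero m}} → IsMultiplicity S m → 2 ≤ k
    → NoAperyBetween c m k → ∀ {x} → Apery S m x → InI c m k x → Primitive S x
  Apery⇒Primitive c {m} k m-mult 2≤k noApery {x} x∈A x∈Iₖ@(_ , x+ρ<[1+k]m) =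
    (proj₁ x∈A , 0<x) , indecomposable
    where
      0<x : 0 < x
      0<x = n≢0⇒n>0 λ { refl →
        contradiction (≤-trans 2≤k (InI⇒index-≤ c m {j = 0} x∈Iₖ (zero∈I₀ c m))) λ () }
      indecomposable : ¬ (Σ ℕ λ a → Σ ℕ λ b → InS* S a × InS* S b × a + b ≡ x)
      indecomposable (a , b , (a∈S , 0<a) , (b∈S , 0<b) , refl) =
        <⇒≱ x+ρ<[1+k]m (high-block-sum 2≤k (ρOf<m c m)
          (Apery-in-high-block c k m-mult noApery (Apery-summand a∈S b∈S x∈A) 0<a)
          (Apery-in-high-block c k m-mult noApery
            (Apery-summand b∈S a∈S (subst (Apery S m) (+-comm a b) x∈A)) 0<b))

  Primitive⇒Apery : ∀ {m x} → InS* S m → Primitive S x → x ≢ m → Apery S m x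
  Primitive⇒Apery {m} {x} m∈S* ((x∈S , _) , indecomposable) x≢m = x∈S , x∉m+S
    where
      x∉m+S : ¬ Σ ℕ λ y → y ∈S × y + m ≡ x
      x∉m+S (zero  , _   , m≡x)   = x≢m (sym m≡x)
      x∉m+S (suc y , y∈S , y+m≡x) = indecomposable (suc y , _ , (y∈S , z<s) , m∈S* , y+m≡x)

corollary2p15 : (S : NumericalSemigroup) (m c : ℕ) .{{_ : NonZero m}}
    → IsMultiplicity S m → IsConductor S c
    → (k : ℕ) → 2 ≤ k
    → Σ ℕ (λ x → Apery S m x × InI c m k x)
    → (∀ i → 1 ≤ i → i < k → ∀ x → Apery S m x → InI c m i x → ⊥)
    → (∀ x → Apery S m x × InI c m k x → Primitive S x × InI c m k x)
    × (∀ x → Primitive S x × InI c m k x → Apery S m x × InI c m k x)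
corollary2p15 S m c m-mult _ k 2≤k _ noApery =
    (λ x (x∈A , x∈Iₖ) → Apery⇒Primitive S c k m-mult 2≤k noApery x∈A x∈Iₖ , x∈Iₖ)
  , (λ x (x∈P , x∈Iₖ) → Primitive⇒Apery S (proj₁ m-mult) x∈P (x≢m x∈Iₖ) , x∈Iₖ)
  where
    x≢m : ∀ {x} → InI c m k x → x ≢ m
    x≢m x∈Iₖ refl =
      contradiction (≤-trans 2≤k (InI⇒index-≤ c m {j = 1} x∈Iₖ (multiplicity∈I₁ c m))) λ { (s≤s ()) }
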